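{- Let $G$ be a finite simple graph admitting an FD-code. If $G$ is the disjoint union of a graph $G'$ and an isolated vertex, then $\gamma^{\mathrm{FD}}(G)=\gamma^{\mathrm{FTD}}(G')+1$; otherwise $\gamma^{\mathrm{FTD}}(G)-1\le\gamma^{\mathrm{FD}}(G)\le\gamma^{\mathrm{FTD}}(G)$.
   Context: For a vertex $v$ of $G=(V,E)$, $N(v)$ is its open and $N[v]=N(v)\cup\{v\}$ its closed neighborhood. A set $C\subseteq V$ is full-separating if for all distinct $u,v\in V$, $(N(v)\cap C)\setminus\{u\}\neq(N(u)\cap C)\setminus\{v\}$; dominating if $N[v]\cap C\neq\emptyset$ for all $v$; total-dominating if $N(v)\cap C\neq\emptyset$ for all $v$. An FD-code is a full-separating dominating set and an FTD-code is a full-separating total-dominating set; $\gamma^{\mathrm{FD}}(G)$ and $\gamma^{\mathrm{FTD}}(G)$ denote their minimum cardinalities. An isolated vertex is a vertex with empty open neighborhood. -}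

module Defs where

open import Data.Nat using (ℕ; suc; _≤_)
open import Data.Bool using (Bool; true; false)
open import Data.Fin using (Fin; punchIn)
open import Data.Fin.Subset using (Subset; _∈_; ∣_∣)
open import Data.Product using (Σ; _×_; ∃; _,_)
open import Data.Sum using (_⊎_)
open import Relation.Binary.PropositionalEquality using (_≡_; _≢_)
open import Relation.Nullary using (¬_)

record Graph (n : ℕ) : Set where
  field
    adj   : Fin n → Fin n → Bool
    sym   : ∀ u v → adj u v ≡ adj v u
    irrefl : ∀ v → adj v v ≡ false
open Graph public

_∈N[_]_ : {n : ℕ} → Fin n → Graph n → Fin n → Set
u ∈N[ G ] v = adj G v u ≡ true

InTrace : {n : ℕ} → Graph n → Subset n → Fin n → Fin n → Fin n → Set
InTrace G C v u w = (w ∈N[ G ] v) × (w ∈ C) × (w ≢ u)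

SameTrace : {n : ℕ} → Graph n → Subset n → Fin n → Fin n → Set
SameTrace G C u v =
  ∀ w → (InTrace G C v u w → InTrace G C u v w) × (InTrace G C u v w → InTrace G C v u w)

FullSeparating : {n : ℕ} → Graph n → Subset n → Set
FullSeparating G C = ∀ u v → u ≢ v → ¬ SameTrace G C u v

Dominating : {n : ℕ} → Graph n → Subset n → Set
Dominating G C = ∀ v → (v ∈ C) ⊎ (∃ λ u → (u ∈N[ G ] v) × (u ∈ C))

TotalDominating : {n : ℕ} → Graph n → Subset n → Set
TotalDominating G C = ∀ v → ∃ λ u → (u ∈N[ G ] v) × (u ∈ C)

FDCode : {n : ℕ} → Graph n → Subset n → Set
FDCode G C = FullSeparating G C × Dominating G C

FTDCode : {n : ℕ} → Graph n → Subset n → Set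
FTDCode G C = FullSeparating G C × TotalDominating G C

IsMinimum : {n : ℕ} → (Subset n → Set) → ℕ → Set
IsMinimum P k = (∃ λ C → P C × ∣ C ∣ ≡ k) × (∀ C → P C → k ≤ ∣ C ∣)

γFD≡ : {n : ℕ} → Graph n → ℕ → Set
γFD≡ G = IsMinimum (FDCode G)

γFTD≡ : {n : ℕ} → Graph n → ℕ → Set
γFTD≡ G = IsMinimum (FTDCode G)

HasFDCode : {n : ℕ} → Graph n → Set
HasFDCode G = ∃ λ C → FDCode G C

IsIsolated : {n : ℕ} → Graph n → Fin n → Set
IsIsolated G v = ∀ u → adj G v u ≡ false

deleteVertex : {n : ℕ} → Graph (suc n) → Fin (suc n) → Graph n
deleteVertex G v = record
  { adj = λ i j → adj G (punchIn v i) (punchIn v j)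
  ; sym = λ i j → sym G (punchIn v i) (punchIn v j)
  ; irrefl = λ i → irrefl G (punchIn v i)
  }

-- Case 1: the isolated vertex v lies in every dominating set and in no trace, so
-- C ↦ C - v and C' ↦ C' + v translate FD-codes of G and FTD-codes of G - v into
-- each other while changing the size by exactly one.
-- Case 2: every FTD-code is an FD-code. Conversely, in a full-separating set C at
-- most one vertex x has no neighbour in C, since two such vertices would have the
-- same empty trace; adding one neighbour of x, which exists as x is not isolated,
-- yields an FTD-code of size at most |C| + 1.

module Submission where

open import Defs
open import Data.Nat using (ℕ; suc; _≤_; _<_; z≤n; s≤s; _+_)
open import Data.Nat.Properties
  using (_<?_; ≮⇒≥; ≤-trans; ≤-reflexive; n≤1+n; +-suc; +-comm; +-monoʳ-≤)
open import Data.Nat.Induction using (<-wellFounded)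
open import Data.Bool.Properties using (¬-not; not-¬)
open import Data.Fin using (Fin; punchIn; punchOut)
open import Data.Fin.Properties using (any?; all?; punchIn-punchOut; punchIn-injective; punchInᵢ≢i)
open import Data.Fin.Subset using (Subset; _∈_; _⊆_; _∪_; ⁅_⁆; ∣_∣; inside; outside)
open import Data.Fin.Subset.Properties using (_∈?_; anySubset?; p⊆p∪q; q⊆p∪q; x∈⁅x⁆; ∣⁅x⁆∣≡1)
open import Data.Vec using ([]; _∷_; lookup; insertAt; removeAt)
open import Data.Vec.Properties
  using (insertAt-lookup; insertAt-punchIn; insertAt-removeAt; []=⇒lookup; lookup⇒[]=)
open import Data.Product using (_×_; ∃; ∃-syntax; _,_; proj₁; proj₂; swap; map₂)
open import Data.Sum using (inj₁; inj₂)
open import Data.Empty using (⊥-elim)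
open import Function using (_∘_)
open import Induction.WellFounded using (Acc; acc)
open import Relation.Nullary using (¬_; Dec; yes; no; ¬?)
open import Relation.Nullary.Decidable using (_×-dec_; _⊎-dec_; _→-dec_; decidable-stable)
open import Relation.Unary using (Decidable)
open import Relation.Binary.PropositionalEquality using (_≡_; _≢_; refl; trans; cong; subst)
import Relation.Binary.PropositionalEquality as ≡

import Data.Bool as Bool
import Data.Fin as Fin

private
  variable
    n : ℕ

minimum-exists : (P : Subset n → Set) → Decidable P → ∃ P → ∃ (IsMinimum P)
minimum-exists P P? (C , pC) = descend C pC (<-wellFounded ∣ C ∣)
  where
  descend : ∀ C → P C → Acc _<_ ∣ C ∣ → ∃ (IsMinimum P)
  descend C pC (acc smaller) with anySubset? (λ D → P? D ×-dec (∣ D ∣ <? ∣ C ∣))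
  ... | yes (D , pD , ∣D∣<∣C∣) = descend D pD (smaller ∣D∣<∣C∣)
  ... | no none = ∣ C ∣ , (C , pC , refl) , λ D pD → ≮⇒≥ (λ ∣D∣<∣C∣ → none (D , pD , ∣D∣<∣C∣))

isMinimum-mono : ∀ {P Q : Subset n → Set} {a b} → (∀ {C} → Q C → P C) →
                 IsMinimum P a → IsMinimum Q b → a ≤ b
isMinimum-mono Q⇒P (_ , leastP) ((D , qD , refl) , _) = leastP D (Q⇒P qD)

isMinimum-≤-suc : ∀ {P Q : Subset n → Set} {a b} → (∀ {C} → P C → ∃ λ D → Q D × ∣ D ∣ ≤ suc ∣ C ∣) →
                  IsMinimum P a → IsMinimum Q b → b ≤ suc a
isMinimum-≤-suc extend ((C , pC , refl) , _) (_ , leastQ) with extend pC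
... | D , qD , ∣D∣≤1+∣C∣ = ≤-trans (leastQ D qD) ∣D∣≤1+∣C∣

isMinimum-suc : ∀ {m} {P : Subset m → Set} {Q : Subset n → Set} {k}
                (f : Subset m → Subset n) (g : Subset n → Subset m) →
                (∀ {C} → P C → Q (f C)) → (∀ {D} → Q D → P (g D)) →
                (∀ {C} → P C → ∣ C ∣ ≡ suc ∣ f C ∣) → (∀ D → ∣ g D ∣ ≡ suc ∣ D ∣) →
                IsMinimum Q k → IsMinimum P (suc k)
isMinimum-suc f g P⇒Q Q⇒P ∣C∣≡1+∣fC∣ ∣gD∣≡1+∣D∣ ((D , qD , refl) , leastQ) =
  (g D , Q⇒P qD , ∣gD∣≡1+∣D∣ D) ,
  λ C pC → subst (suc ∣ D ∣ ≤_) (≡.sym (∣C∣≡1+∣fC∣ pC)) (s≤s (leastQ (f C) (P⇒Q pC)))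

∣p∪q∣≤∣p∣+∣q∣ : (p q : Subset n) → ∣ p ∪ q ∣ ≤ ∣ p ∣ + ∣ q ∣
∣p∪q∣≤∣p∣+∣q∣ []            []            = z≤n
∣p∪q∣≤∣p∣+∣q∣ (outside ∷ p) (outside ∷ q) = ∣p∪q∣≤∣p∣+∣q∣ p q
∣p∪q∣≤∣p∣+∣q∣ (outside ∷ p) (inside  ∷ q) =
  ≤-trans (s≤s (∣p∪q∣≤∣p∣+∣q∣ p q)) (≤-reflexive (≡.sym (+-suc ∣ p ∣ ∣ q ∣)))
∣p∪q∣≤∣p∣+∣q∣ (inside  ∷ p) (outside ∷ q) = s≤s (∣p∪q∣≤∣p∣+∣q∣ p q)
∣p∪q∣≤∣p∣+∣q∣ (inside  ∷ p) (inside  ∷ q) =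
  s≤s (≤-trans (∣p∪q∣≤∣p∣+∣q∣ p q) (+-monoʳ-≤ ∣ p ∣ (n≤1+n ∣ q ∣)))

∣p∪⁅x⁆∣≤1+∣p∣ : (p : Subset n) (x : Fin n) → ∣ p ∪ ⁅ x ⁆ ∣ ≤ suc ∣ p ∣
∣p∪⁅x⁆∣≤1+∣p∣ p x = ≤-trans (∣p∪q∣≤∣p∣+∣q∣ p ⁅ x ⁆)
  (≤-reflexive (trans (cong (∣ p ∣ +_) (∣⁅x⁆∣≡1 x)) (+-comm ∣ p ∣ 1)))

∣insertAt-inside∣ : (p : Subset n) (i : Fin (suc n)) → ∣ insertAt p i inside ∣ ≡ suc ∣ p ∣
∣insertAt-inside∣ p             Fin.zero    = refl
∣insertAt-inside∣ (inside  ∷ p) (Fin.suc i) = cong suc (∣insertAt-inside∣ p i)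
∣insertAt-inside∣ (outside ∷ p) (Fin.suc i) = ∣insertAt-inside∣ p i

∣removeAt-∈∣ : (p : Subset (suc n)) {i : Fin (suc n)} → i ∈ p → ∣ p ∣ ≡ suc ∣ removeAt p i ∣
∣removeAt-∈∣ p {i} i∈p = begin
  ∣ p ∣                                      ≡⟨ cong ∣_∣ (≡.sym (insertAt-removeAt p i)) ⟩
  ∣ insertAt (removeAt p i) i (lookup p i) ∣ ≡⟨ cong (∣_∣ ∘ insertAt (removeAt p i) i) ([]=⇒lookup i∈p) ⟩
  ∣ insertAt (removeAt p i) i inside ∣       ≡⟨ ∣insertAt-inside∣ (removeAt p i) i ⟩
  suc ∣ removeAt p i ∣                       ∎
  where open ≡.≡-Reasoning

data PunchInView (v : Fin (suc n)) : Fin (suc n) → Set where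
  hole    : PunchInView v v
  punched : (i : Fin n) → PunchInView v (punchIn v i)

punchInView : (v w : Fin (suc n)) → PunchInView v w
punchInView v w with v Fin.≟ w
... | yes refl = hole
... | no v≢w   = subst (PunchInView v) (punchIn-punchOut v≢w) (punched (punchOut v≢w))

HasNeighbourIn : Graph n → Subset n → Fin n → Set
HasNeighbourIn G C x = ∃ λ u → (u ∈N[ G ] x) × (u ∈ C)

module _ (G : Graph n) where

  hasNeighbourIn? : ∀ C → Decidable (HasNeighbourIn G C)
  hasNeighbourIn? C x = any? λ u → (adj G x u Bool.≟ Bool.true) ×-dec (u ∈? C)

  sameTrace? : ∀ C u v → Dec (SameTrace G C u v)
  sameTrace? C u v = all? λ w → (inTrace? v u w →-dec inTrace? u v w) ×-dec (inTrace? u v w →-dec inTrace? v u w)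
    where
    inTrace? : ∀ x y w → Dec (InTrace G C x y w)
    inTrace? x y w = (adj G x w Bool.≟ Bool.true) ×-dec ((w ∈? C) ×-dec ¬? (w Fin.≟ y))

  fullSeparating? : Decidable (FullSeparating G)
  fullSeparating? C = all? λ u → all? λ v → ¬? (u Fin.≟ v) →-dec ¬? (sameTrace? C u v)

  fdCode? : Decidable (FDCode G)
  fdCode? C = fullSeparating? C ×-dec all? (λ v → (v ∈? C) ⊎-dec hasNeighbourIn? C v)

  ftdCode? : Decidable (FTDCode G)
  ftdCode? C = fullSeparating? C ×-dec all? (hasNeighbourIn? C)

  ftd⇒fd : ∀ {C} → FTDCode G C → FDCode G C
  ftd⇒fd (fs , td) = fs , inj₂ ∘ td

  sameTrace-sym : ∀ {C x y} → SameTrace G C x y → SameTrace G C y x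
  sameTrace-sym st = swap ∘ st

  noNeighbours⇒sameTrace : ∀ {C x y} → ¬ HasNeighbourIn G C x → ¬ HasNeighbourIn G C y → SameTrace G C x y
  noNeighbours⇒sameTrace ¬Nx ¬Ny w =
    (λ (w∈Ny , w∈C , _) → ⊥-elim (¬Ny (w , w∈Ny , w∈C))) ,
    (λ (w∈Nx , w∈C , _) → ⊥-elim (¬Nx (w , w∈Nx , w∈C)))

  fullSeparating⇒hasNeighbourIn : ∀ {C} → FullSeparating G C → ∀ {x y} → x ≢ y →
                                   ¬ HasNeighbourIn G C y → HasNeighbourIn G C x
  fullSeparating⇒hasNeighbourIn {C} fs {x} x≢y ¬Ny = decidable-stable (hasNeighbourIn? C x)
    λ ¬Nx → fs x _ x≢y (noNeighbours⇒sameTrace ¬Nx ¬Ny)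

  fullSeparating-⊆ : ∀ {C D} → C ⊆ D → FullSeparating G C → FullSeparating G D
  fullSeparating-⊆ {C} {D} C⊆D fs x y x≢y st = fs x y x≢y λ w →
    (λ t@(_ , w∈C , _) → restrict w∈C (proj₁ (st w) (widen t))) ,
    (λ t@(_ , w∈C , _) → restrict w∈C (proj₂ (st w) (widen t)))
    where
    widen : ∀ {x y w} → InTrace G C x y w → InTrace G D x y w
    widen (w∈Nx , w∈C , w≢y) = w∈Nx , C⊆D w∈C , w≢y
    restrict : ∀ {x y w} → w ∈ C → InTrace G D x y w → InTrace G C x y w
    restrict w∈C (w∈Nx , _ , w≢y) = w∈Nx , w∈C , w≢y

  nonIsolated⇒neighbour : ∀ {x} → ¬ IsIsolated G x → ∃ λ u → u ∈N[ G ] x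
  nonIsolated⇒neighbour {x} ¬iso = decidable-stable (any? λ u → adj G x u Bool.≟ Bool.true)
    λ none → ¬iso λ u → ¬-not λ x~u → none (u , x~u)

  isolated⇒w∉N[v] : ∀ {v} → IsIsolated G v → ∀ w → ¬ (w ∈N[ G ] v)
  isolated⇒w∉N[v] iso w = not-¬ (iso w)

  isolated⇒v∉N[x] : ∀ {v} → IsIsolated G v → ∀ x → ¬ (v ∈N[ G ] x)
  isolated⇒v∉N[x] {v} iso x = not-¬ (trans (sym G x v) (iso x))

  hasNeighbourIn⇒¬sameTrace-isolated : ∀ {C v x} → IsIsolated G v →
                                       HasNeighbourIn G C x → ¬ SameTrace G C x v
  hasNeighbourIn⇒¬sameTrace-isolated {v = v} {x} iso (u , u∈Nx , u∈C) st =
    isolated⇒w∉N[v] iso u (proj₁ (proj₂ (st u) (u∈Nx , u∈C , u≢v)))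
    where
    u≢v : u ≢ v
    u≢v refl = isolated⇒v∉N[x] iso x u∈Nx

  isolated⇒¬hasNeighbourIn : ∀ {C v} → IsIsolated G v → ¬ HasNeighbourIn G C v
  isolated⇒¬hasNeighbourIn iso (u , u∈Nv , _) = isolated⇒w∉N[v] iso u u∈Nv

  dominating⇒∈-isolated : ∀ {C v} → IsIsolated G v → Dominating G C → v ∈ C
  dominating⇒∈-isolated {v = v} iso dom with dom v
  ... | inj₁ v∈C = v∈C
  ... | inj₂ Nv  = ⊥-elim (isolated⇒¬hasNeighbourIn iso Nv)

  fullSeparating⇒ftdCode+1 : ∀ {C} → (∀ v → ¬ IsIsolated G v) → FullSeparating G C →
                             ∃ λ D → FTDCode G D × ∣ D ∣ ≤ suc ∣ C ∣
  fullSeparating⇒ftdCode+1 {C} noIso fs with any? (λ x → ¬? (hasNeighbourIn? C x))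
  ... | no allDominated =
    C , (fs , λ x → decidable-stable (hasNeighbourIn? C x) λ ¬Nx → allDominated (x , ¬Nx)) , n≤1+n ∣ C ∣
  ... | yes (x , ¬Nx) with nonIsolated⇒neighbour (noIso x)
  ...   | w , w∈Nx = C ∪ ⁅ w ⁆ , (fullSeparating-⊆ (p⊆p∪q ⁅ w ⁆) fs , totalDominating) , ∣p∪⁅x⁆∣≤1+∣p∣ C w
    where
    totalDominating : TotalDominating G (C ∪ ⁅ w ⁆)
    totalDominating y with y Fin.≟ x
    ... | yes refl = w , w∈Nx , q⊆p∪q C ⁅ w ⁆ (x∈⁅x⁆ w)
    ... | no y≢x with fullSeparating⇒hasNeighbourIn fs y≢x ¬Nx
    ...   | u , u∈Ny , u∈C = u , u∈Ny , p⊆p∪q ⁅ w ⁆ u∈C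

module DeleteIsolated (G : Graph (suc n)) {v : Fin (suc n)} (iso : IsIsolated G v) where

  G′ : Graph n
  G′ = deleteVertex G v

  Restriction : Subset (suc n) → Subset n → Set
  Restriction C C′ = ∀ i → lookup C′ i ≡ lookup C (punchIn v i)

  removeAt-restriction : ∀ C → Restriction C (removeAt C v)
  removeAt-restriction C i = begin
    lookup (removeAt C v) i
      ≡⟨ insertAt-punchIn (removeAt C v) v (lookup C v) i ⟨
    lookup (insertAt (removeAt C v) v (lookup C v)) (punchIn v i)
      ≡⟨ cong (λ D → lookup D (punchIn v i)) (insertAt-removeAt C v) ⟩
    lookup C (punchIn v i)
      ∎
    where open ≡.≡-Reasoning

  insertAt-restriction : ∀ C′ → Restriction (insertAt C′ v inside) C′
  insertAt-restriction C′ i = ≡.sym (insertAt-punchIn C′ v inside i)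

  module _ {C C′} (r : Restriction C C′) where

    ∈-restriction⁺ : ∀ {i} → i ∈ C′ → punchIn v i ∈ C
    ∈-restriction⁺ {i} i∈C′ = lookup⇒[]= (punchIn v i) C (trans (≡.sym (r i)) ([]=⇒lookup i∈C′))

    ∈-restriction⁻ : ∀ {i} → punchIn v i ∈ C → i ∈ C′
    ∈-restriction⁻ {i} pi∈C = lookup⇒[]= i C′ (trans (r i) ([]=⇒lookup pi∈C))

    inTrace-punchIn⁺ : ∀ {x y w} → InTrace G′ C′ x y w → InTrace G C (punchIn v x) (punchIn v y) (punchIn v w)
    inTrace-punchIn⁺ {y = y} {w} (w∈Nx , w∈C′ , w≢y) =
      w∈Nx , ∈-restriction⁺ w∈C′ , w≢y ∘ punchIn-injective v w y

    inTrace-punchIn⁻ : ∀ {x y w} → InTrace G C (punchIn v x) (punchIn v y) (punchIn v w) → InTrace G′ C′ x y w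
    inTrace-punchIn⁻ (w∈Nx , w∈C , w≢y) = w∈Nx , ∈-restriction⁻ w∈C , w≢y ∘ cong (punchIn v)

    sameTrace-punchIn⁻ : ∀ {x y} → SameTrace G C (punchIn v x) (punchIn v y) → SameTrace G′ C′ x y
    sameTrace-punchIn⁻ st w =
      (inTrace-punchIn⁻ ∘ proj₁ (st (punchIn v w)) ∘ inTrace-punchIn⁺) ,
      (inTrace-punchIn⁻ ∘ proj₂ (st (punchIn v w)) ∘ inTrace-punchIn⁺)

    sameTrace-punchIn⁺ : ∀ {x y} → SameTrace G′ C′ x y → SameTrace G C (punchIn v x) (punchIn v y)
    sameTrace-punchIn⁺ st w with punchInView v w
    ... | hole      = (λ (v∈Ny , _) → ⊥-elim (isolated⇒v∉N[x] G iso _ v∈Ny)) ,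
                      (λ (v∈Nx , _) → ⊥-elim (isolated⇒v∉N[x] G iso _ v∈Nx))
    ... | punched w′ =
      (inTrace-punchIn⁺ ∘ proj₁ (st w′) ∘ inTrace-punchIn⁻) ,
      (inTrace-punchIn⁺ ∘ proj₂ (st w′) ∘ inTrace-punchIn⁻)

    hasNeighbourIn-punchIn⁺ : ∀ {x} → HasNeighbourIn G′ C′ x → HasNeighbourIn G C (punchIn v x)
    hasNeighbourIn-punchIn⁺ (u , u∈Nx , u∈C′) = punchIn v u , u∈Nx , ∈-restriction⁺ u∈C′

    hasNeighbourIn-punchIn⁻ : ∀ {x} → HasNeighbourIn G C (punchIn v x) → HasNeighbourIn G′ C′ x
    hasNeighbourIn-punchIn⁻ (u , u∈Nx , u∈C) with punchInView v u
    ... | hole       = ⊥-elim (isolated⇒v∉N[x] G iso _ u∈Nx)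
    ... | punched u′ = u′ , u∈Nx , ∈-restriction⁻ u∈C

  removeAt-ftdCode : ∀ {C} → FullSeparating G C → FTDCode G′ (removeAt C v)
  removeAt-ftdCode {C} fs = fullSeparating′ , totalDominating′
    where
    r = removeAt-restriction C

    fullSeparating′ : FullSeparating G′ (removeAt C v)
    fullSeparating′ x y x≢y = fs (punchIn v x) (punchIn v y) (x≢y ∘ punchIn-injective v x y) ∘ sameTrace-punchIn⁺ r

    totalDominating′ : TotalDominating G′ (removeAt C v)
    totalDominating′ x = hasNeighbourIn-punchIn⁻ r
      (fullSeparating⇒hasNeighbourIn G fs (punchInᵢ≢i v x) (isolated⇒¬hasNeighbourIn G iso))

  insertAt-fdCode : ∀ {C′} → FTDCode G′ C′ → FDCode G (insertAt C′ v inside)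
  insertAt-fdCode {C′} (fs′ , td′) = fullSeparating , dominating
    where
    C = insertAt C′ v inside
    r = insertAt-restriction C′

    dominated : ∀ i → HasNeighbourIn G C (punchIn v i)
    dominated i = hasNeighbourIn-punchIn⁺ r (td′ i)

    dominating : Dominating G C
    dominating y with punchInView v y
    ... | hole      = inj₁ (lookup⇒[]= v C (insertAt-lookup C′ v inside))
    ... | punched i = inj₂ (dominated i)

    fullSeparating : FullSeparating G C
    fullSeparating x y x≢y with punchInView v x | punchInView v y
    ... | hole      | hole      = ⊥-elim (x≢y refl)
    ... | hole      | punched j = hasNeighbourIn⇒¬sameTrace-isolated G iso (dominated j) ∘ sameTrace-sym G
    ... | punched i | hole      = hasNeighbourIn⇒¬sameTrace-isolated G iso (dominated i)
    ... | punched i | punched j = fs′ i j (x≢y ∘ cong (punchIn v)) ∘ sameTrace-punchIn⁻ r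

  γFD≡1+γFTD′ : HasFDCode G → ∃[ k ] (γFTD≡ G′ k × γFD≡ G (suc k))
  γFD≡1+γFTD′ (C , fs , _)
    with minimum-exists (FTDCode G′) (ftdCode? G′) (removeAt C v , removeAt-ftdCode fs)
  ... | k , γFTD′ = k , γFTD′ ,
    isMinimum-suc (λ C → removeAt C v) (λ C′ → insertAt C′ v inside)
      (removeAt-ftdCode ∘ proj₁) insertAt-fdCode
      (λ (_ , dom) → ∣removeAt-∈∣ _ (dominating⇒∈-isolated G iso dom)) (λ C′ → ∣insertAt-inside∣ C′ v)
      γFTD′

γFD≤γFTD≤1+γFD : (G : Graph n) → HasFDCode G → (∀ v → ¬ IsIsolated G v) →
                 ∃[ a ] ∃[ b ] (γFD≡ G a × γFTD≡ G b × b ≤ suc a × a ≤ b)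
γFD≤γFTD≤1+γFD G (C , fdC) noIso
  with minimum-exists (FDCode G) (fdCode? G) (C , fdC)
     | minimum-exists (FTDCode G) (ftdCode? G) (map₂ proj₁ (fullSeparating⇒ftdCode+1 G noIso (proj₁ fdC)))
... | a , γFD | b , γFTD = a , b , γFD , γFTD ,
  isMinimum-≤-suc (fullSeparating⇒ftdCode+1 G noIso ∘ proj₁) γFD γFTD ,
  isMinimum-mono (ftd⇒fd G) γFD γFTD

theorem2 : (∀ (n : ℕ) (G : Graph (suc n)) (v : Fin (suc n)) → HasFDCode G → IsIsolated G v →
    ∃[ k ] (γFTD≡ (deleteVertex G v) k × γFD≡ G (suc k)))
    ×
    (∀ (n : ℕ) (G : Graph n) → HasFDCode G → (∀ v → ¬ IsIsolated G v) →
    ∃[ a ] ∃[ b ] (γFD≡ G a × γFTD≡ G b × b ≤ suc a × a ≤ b))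
theorem2 = (λ _ G v hasFD iso → DeleteIsolated.γFD≡1+γFTD′ G iso hasFD) ,
           (λ _ → γFD≤γFTD≤1+γFD)
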